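{- If $f\in\#\mathsf{FA}$, then for every $c\in\mathbb{N}\setminus\{0\}$ the function $w\mapsto\lfloor f(w)/c\rfloor$ is in $\#\mathsf{FA}$.
   Context: $\mathbb{N}=\{0,1,2,\dots\}$. An NFA is a tuple $M=(Q,\Sigma,\mathrm{wt},\mathrm{in},\mathrm{out})$ with $Q,\Sigma$ finite, $\mathrm{wt}:Q\times\Sigma\times Q\to\mathbb{N}$, $\mathrm{in},\mathrm{out}:Q\to\mathbb{N}$; on input $w=w_1\cdots w_n$ it outputs $\sum_{q_0,\dots,q_n\in Q}\mathrm{in}(q_0)\prod_{i=1}^n\mathrm{wt}(q_{i-1},w_i,q_i)\mathrm{out}(q_n)$. $\#\mathsf{FA}$ is the set of functions $\Sigma^\star\to\mathbb{N}$ (over finite alphabets $\Sigma$) computed by NFAs. -}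

module Defs where

open import Data.Nat using (ℕ; zero; suc; _+_; _*_)
open import Data.Fin using (Fin; zero; suc)
open import Data.List using (List; []; _∷_)
open import Data.Product using (∃; ∃-syntax)
open import Relation.Binary.PropositionalEquality using (_≡_)

Σ[<_]_ : (n : ℕ) → (Fin n → ℕ) → ℕ
Σ[< zero ] f = 0
Σ[< suc n ] f = f zero + Σ[< n ] (λ i → f (suc i))

record NFA (k : ℕ) : Set where
  field
    states : ℕ
    wt     : Fin states → Fin k → Fin states → ℕ
    inW    : Fin states → ℕ
    outW   : Fin states → ℕ

open NFA public

runFrom : ∀ {k} (M : NFA k) → Fin (states M) → List (Fin k) → ℕ
runFrom M q []      = outW M q
runFrom M q (a ∷ w) = Σ[< states M ] (λ q' → wt M q a q' * runFrom M q' w)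

-- Output of M on w: Σ_{q₀,…,qₙ} in(q₀) ∏ wt(qᵢ₋₁,wᵢ,qᵢ) out(qₙ).
eval : ∀ {k} (M : NFA k) → List (Fin k) → ℕ
eval M w = Σ[< states M ] (λ q → inW M q * runFrom M q w)

InSharpFA : ∀ {k} → (List (Fin k) → ℕ) → Set
InSharpFA {k} f = ∃[ M ] ((w : List (Fin k)) → eval M w ≡ f w)

-- A weighted automaton for ⌊f/d⌋ keeps a copy of M and adds one state per residue
-- vector r ∈ (Fin d)^Q, whose run weight on w is ⌊(Σ_q r_q · M_q(w))/d⌋, M_q(w) being
-- the weight of the runs of M from q.  Reading a letter a turns r into u = r · wt(a);
-- since ⌊(Σ_q u_q x_q)/d⌋ = Σ_q ⌊u_q/d⌋ x_q + ⌊(Σ_q (u_q mod d) x_q)/d⌋, the quotients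
-- become transitions into the copy of M and the remainders form the unique next residue
-- state.  The initial weights are split the same way.
module Submission where

open import Defs
open import Data.Nat using (ℕ; zero; suc; _+_; _*_; _/_; _%_; _^_; NonZero)
open import Data.Nat.Properties using (+-*-semiring; +-assoc; +-comm; +-identityʳ; *-assoc)
open import Algebra.Properties.Semiring.Sum +-*-semiring
  using (sum; sum-cong-≗; sum-replicate-zero; ∑-distrib-+; ∑-comm; *-distribˡ-sum; *-distribʳ-sum)
open import Data.Nat.DivMod using (_mod_; m≡m%n+[m/n]*n; +-distrib-/-∣ʳ; m*n/n≡m)
open import Data.Nat.Divisibility using (divides-refl)
open import Data.Nat.Solver using (module +-*-Solver)
open import Data.Fin using (Fin; zero; suc; toℕ; splitAt; finToFun; funToFin)
open import Data.Fin.Properties using (toℕ-fromℕ<; finToFun-funToFin)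
open import Data.List using (List; []; _∷_)
open import Data.Sum using (_⊎_; inj₁; inj₂; map₁)
open import Data.Product using (_,_)
open import Function using (_∘_)
open import Relation.Binary.PropositionalEquality

open +-*-Solver using (solve; _:+_; _:*_; _:=_)
open ≡-Reasoning

Σ≡sum : ∀ n (f : Fin n → ℕ) → Σ[< n ] f ≡ sum f
Σ≡sum zero    f = refl
Σ≡sum (suc n) f = cong (f zero +_) (Σ≡sum n (f ∘ suc))

Σ-cong : ∀ n {f g : Fin n → ℕ} → (∀ i → f i ≡ g i) → Σ[< n ] f ≡ Σ[< n ] g
Σ-cong n {f} {g} f≗g = trans (Σ≡sum n f) (trans (sum-cong-≗ f≗g) (sym (Σ≡sum n g)))

Σ-zero : ∀ n → Σ[< n ] (λ _ → 0) ≡ 0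
Σ-zero n = trans (Σ≡sum n _) (sum-replicate-zero n)

Σ-distrib-+ : ∀ n (f g : Fin n → ℕ) → Σ[< n ] (λ i → f i + g i) ≡ Σ[< n ] f + Σ[< n ] g
Σ-distrib-+ n f g = begin
  Σ[< n ] (λ i → f i + g i) ≡⟨ Σ≡sum n _ ⟩
  sum (λ i → f i + g i)     ≡⟨ ∑-distrib-+ f g ⟩
  sum f + sum g             ≡⟨ sym (cong₂ _+_ (Σ≡sum n f) (Σ≡sum n g)) ⟩
  Σ[< n ] f + Σ[< n ] g     ∎

*-distribˡ-Σ : ∀ n x (f : Fin n → ℕ) → x * Σ[< n ] f ≡ Σ[< n ] (λ i → x * f i)
*-distribˡ-Σ n x f = begin
  x * Σ[< n ] f            ≡⟨ cong (x *_) (Σ≡sum n f) ⟩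
  x * sum f                ≡⟨ *-distribˡ-sum x f ⟩
  sum (λ i → x * f i)      ≡⟨ sym (Σ≡sum n _) ⟩
  Σ[< n ] (λ i → x * f i)  ∎

*-distribʳ-Σ : ∀ n x (f : Fin n → ℕ) → Σ[< n ] f * x ≡ Σ[< n ] (λ i → f i * x)
*-distribʳ-Σ n x f = begin
  Σ[< n ] f * x            ≡⟨ cong (_* x) (Σ≡sum n f) ⟩
  sum f * x                ≡⟨ *-distribʳ-sum x f ⟩
  sum (λ i → f i * x)      ≡⟨ sym (Σ≡sum n _) ⟩
  Σ[< n ] (λ i → f i * x)  ∎

Σ-comm : ∀ n m (f : Fin n → Fin m → ℕ) →
         Σ[< n ] (λ i → Σ[< m ] (f i)) ≡ Σ[< m ] (λ j → Σ[< n ] (λ i → f i j))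
Σ-comm n m f = begin
  Σ[< n ] (λ i → Σ[< m ] (f i))           ≡⟨ Σ-cong n (λ i → Σ≡sum m (f i)) ⟩
  Σ[< n ] (λ i → sum (f i))               ≡⟨ Σ≡sum n _ ⟩
  sum (λ i → sum (f i))                   ≡⟨ ∑-comm f ⟩
  sum (λ j → sum (λ i → f i j))           ≡⟨ sym (Σ≡sum m _) ⟩
  Σ[< m ] (λ j → sum (λ i → f i j))       ≡⟨ sym (Σ-cong m (λ j → Σ≡sum n _)) ⟩
  Σ[< m ] (λ j → Σ[< n ] (λ i → f i j))   ∎

Σ-splitAt : ∀ n m (g : Fin n ⊎ Fin m → ℕ) →
            Σ[< n + m ] (g ∘ splitAt n) ≡ Σ[< n ] (g ∘ inj₁) + Σ[< m ] (g ∘ inj₂)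
Σ-splitAt zero    m g = refl
Σ-splitAt (suc n) m g = trans (cong (g (inj₁ zero) +_) (Σ-splitAt n m (g ∘ map₁ suc)))
                              (sym (+-assoc (g (inj₁ zero)) _ _))

Σ-*-Σ-assoc : ∀ n m (u : Fin n → ℕ) (A : Fin n → Fin m → ℕ) (x : Fin m → ℕ) →
              Σ[< n ] (λ i → u i * Σ[< m ] (λ j → A i j * x j))
              ≡ Σ[< m ] (λ j → Σ[< n ] (λ i → u i * A i j) * x j)
Σ-*-Σ-assoc n m u A x = begin
  Σ[< n ] (λ i → u i * Σ[< m ] (λ j → A i j * x j))
    ≡⟨ Σ-cong n (λ i → trans (*-distribˡ-Σ m (u i) _) (Σ-cong m (λ j → sym (*-assoc (u i) _ _)))) ⟩
  Σ[< n ] (λ i → Σ[< m ] (λ j → u i * A i j * x j))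
    ≡⟨ Σ-comm n m _ ⟩
  Σ[< m ] (λ j → Σ[< n ] (λ i → u i * A i j * x j))
    ≡⟨ Σ-cong m (λ j → sym (*-distribʳ-Σ n (x j) _)) ⟩
  Σ[< m ] (λ j → Σ[< n ] (λ i → u i * A i j) * x j) ∎

δ : ∀ {n} → Fin n → Fin n → ℕ
δ zero    zero    = 1
δ zero    (suc _) = 0
δ (suc _) zero    = 0
δ (suc i) (suc j) = δ i j

Σ-δ : ∀ n (e : Fin n) (g : Fin n → ℕ) → Σ[< n ] (λ i → δ i e * g i) ≡ g e
Σ-δ (suc n) zero    g = trans (cong₂ _+_ (+-identityʳ (g zero)) (Σ-zero n)) (+-identityʳ (g zero))
Σ-δ (suc n) (suc e) g = Σ-δ n e (g ∘ suc)

Σ-*-/ : ∀ n d .{{_ : NonZero d}} (u x : Fin n → ℕ) →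
        Σ[< n ] (λ i → u i * x i) / d
        ≡ Σ[< n ] (λ i → u i / d * x i) + Σ[< n ] (λ i → u i % d * x i) / d
Σ-*-/ n d u x = begin
  Σ[< n ] (λ i → u i * x i) / d
    ≡⟨ cong (_/ d) (Σ-cong n split) ⟩
  Σ[< n ] (λ i → u i % d * x i + u i / d * x i * d) / d
    ≡⟨ cong (_/ d) (trans (Σ-distrib-+ n _ _) (cong (R +_) (sym (*-distribʳ-Σ n d _)))) ⟩
  (R + Q * d) / d
    ≡⟨ +-distrib-/-∣ʳ R (divides-refl Q) ⟩
  R / d + Q * d / d
    ≡⟨ cong (R / d +_) (m*n/n≡m Q d) ⟩
  R / d + Q
    ≡⟨ +-comm (R / d) Q ⟩
  Q + R / d ∎
  where
  Q = Σ[< n ] (λ i → u i / d * x i)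
  R = Σ[< n ] (λ i → u i % d * x i)
  split : ∀ i → u i * x i ≡ u i % d * x i + u i / d * x i * d
  split i = trans (cong (_* x i) (m≡m%n+[m/n]*n (u i) d))
    (solve 4 (λ r q y e → (r :+ q :* e) :* y := r :* y :+ q :* y :* e) refl (u i % d) (u i / d) (x i) d)

module Quotient {k} (M : NFA k) (d : ℕ) .{{_ : NonZero d}} where

  private
    n = states M

  Run : (Fin n → ℕ) → List (Fin k) → ℕ
  Run u w = Σ[< n ] (λ q → u q * runFrom M q w)

  _·_ : (Fin n → ℕ) → Fin k → Fin n → ℕ
  (u · a) q′ = Σ[< n ] (λ q → u q * wt M q a q′)

  Run-∷ : ∀ u a w → Run u (a ∷ w) ≡ Run (u · a) w
  Run-∷ u a w = Σ-*-Σ-assoc n n u (λ q q′ → wt M q a q′) (λ q′ → runFrom M q′ w)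

  -- A residue state is a vector Fin n → Fin d, stored as its code in Fin (d ^ n).
  remainders : (Fin n → ℕ) → Fin (d ^ n)
  remainders u = funToFin (λ q → u q mod d)

  coefficients : Fin (d ^ n) → Fin n → ℕ
  coefficients r q = toℕ (finToFun r q)

  coefficients-remainders : ∀ u q → coefficients (remainders u) q ≡ u q % d
  coefficients-remainders u q = trans (cong toℕ (finToFun-funToFin _ q)) (toℕ-fromℕ< _)

  State : Set
  State = Fin n ⊎ Fin (d ^ n)

  Σ⊎ : (State → ℕ) → ℕ
  Σ⊎ g = Σ[< n ] (g ∘ inj₁) + Σ[< d ^ n ] (g ∘ inj₂)

  weight : State → List (Fin k) → ℕ
  weight (inj₁ q) w = runFrom M q w
  weight (inj₂ r) w = Run (coefficients r) w / d

  carry : (Fin n → ℕ) → State → ℕ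
  carry u (inj₁ q) = u q / d
  carry u (inj₂ r) = δ r (remainders u)

  transition : State → Fin k → State → ℕ
  transition (inj₁ q) a (inj₁ q′) = wt M q a q′
  transition (inj₁ q) a (inj₂ r)  = 0
  transition (inj₂ r) a           = carry (coefficients r · a)

  carry-weight : ∀ u w → Σ⊎ (λ s → carry u s * weight s w) ≡ Run u w / d
  carry-weight u w = begin
    Q + Σ[< d ^ n ] (λ r → δ r (remainders u) * weight (inj₂ r) w)
      ≡⟨ cong (Q +_) (Σ-δ (d ^ n) (remainders u) _) ⟩
    Q + Run (coefficients (remainders u)) w / d
      ≡⟨ cong (λ z → Q + z / d) (Σ-cong n (λ q → cong (_* runFrom M q w) (coefficients-remainders u q))) ⟩
    Q + Σ[< n ] (λ q → u q % d * runFrom M q w) / d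
      ≡⟨ sym (Σ-*-/ n d u _) ⟩
    Run u w / d ∎
    where Q = Σ[< n ] (λ q → u q / d * runFrom M q w)

  transition-weight : ∀ s a w → Σ⊎ (λ t → transition s a t * weight t w) ≡ weight s (a ∷ w)
  transition-weight (inj₁ q) a w = trans (cong (runFrom M q (a ∷ w) +_) (Σ-zero (d ^ n))) (+-identityʳ _)
  transition-weight (inj₂ r) a w = trans (carry-weight (coefficients r · a) w)
                                         (cong (_/ d) (sym (Run-∷ (coefficients r) a w)))

  N : NFA k
  N = record
    { states = n + d ^ n
    ; wt     = λ s a t → transition (splitAt n s) a (splitAt n t)
    ; inW    = carry (inW M) ∘ splitAt n
    ; outW   = λ s → weight (splitAt n s) []
    }

  Σ-states : ∀ w (g : State → ℕ) →
             Σ[< n + d ^ n ] (λ t → g (splitAt n t) * runFrom N t w) ≡ Σ⊎ (λ t → g t * weight t w)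

  runFrom-N : ∀ w s → runFrom N s w ≡ weight (splitAt n s) w
  runFrom-N []      s = refl
  runFrom-N (a ∷ w) s = begin
    Σ[< n + d ^ n ] (λ t → transition (splitAt n s) a (splitAt n t) * runFrom N t w)
      ≡⟨ Σ-states w (transition (splitAt n s) a) ⟩
    Σ⊎ (λ t → transition (splitAt n s) a t * weight t w)
      ≡⟨ transition-weight (splitAt n s) a w ⟩
    weight (splitAt n s) (a ∷ w) ∎

  Σ-states w g = trans (Σ-cong (n + d ^ n) (λ t → cong (g (splitAt n t) *_) (runFrom-N w t)))
                       (Σ-splitAt n (d ^ n) (λ t → g t * weight t w))

  eval-N : ∀ w → eval N w ≡ eval M w / d
  eval-N w = trans (Σ-states w (carry (inW M))) (carry-weight (inW M) w)

lemma9 : (k : ℕ) (f : List (Fin k) → ℕ) → InSharpFA f →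
         (c : ℕ) → InSharpFA (λ w → f w / suc c)
lemma9 k f (M , M≡f) c = N , λ w → trans (eval-N w) (cong (_/ suc c) (M≡f w))
  where open Quotient M (suc c)
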